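{- Let $T$ be a tree with order $p$ and diameter $d \ge 2$, and let $\varepsilon = \varepsilon(T)$. Then $$\mathrm{rn}(T) = (p-1)(d+\varepsilon) - 2L(T) + \varepsilon$$ holds if and only if there exists a linear order $u_0, u_1, \ldots, u_{p-1}$ of the vertices of $T$ such that (a) $u_0 = w$ and $u_{p-1}$ is a neighbour of $w$ when $W(T) = \{w\}$, and $\{u_0, u_{p-1}\} = \{w, w'\}$ when $W(T) = \{w, w'\}$; (b) for all $0 \le i < j \le p-1$, $$d(u_i,u_j) \ge \sum_{t=i}^{j-1} \big(L(u_t) + L(u_{t+1})\big) - (j-i)(d+\varepsilon) + (d+1).$$ Moreover, under this condition the mapping $f$ defined by $f(u_0) = 0$ and $f(u_{i+1}) = f(u_i) - L(u_{i+1}) - L(u_i) + (d+\varepsilon)$ for $0 \le i \le p-2$ is an optimal radio labeling of $T$ (i.e. a radio labeling with span $\mathrm{rn}(T)$).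
   Context: For a connected graph $G$ with diameter $\mathrm{diam}(G)$ and distance $d(u,v)$, a radio labeling is a map $f: V(G) \to \{0,1,2,\ldots\}$ with $d(u,v) + |f(u)-f(v)| \ge \mathrm{diam}(G)+1$ for all distinct $u,v$; its span is $\max\{|f(u)-f(v)| : u,v \in V(G)\}$, and the radio number $\mathrm{rn}(G)$ is the minimum span over all radio labelings. For a tree $T$ and $v \in V(T)$, let $w_T(v) = \sum_{u \in V(T)} d(u,v)$; a weight centre of $T$ is a vertex minimizing $w_T$, and $W(T)$ denotes the set of weight centres. Every tree has either one weight centre or two weight centres, and in the latter case they are adjacent. Define $\varepsilon(T) = 1$ if $T$ has exactly one weight centre and $\varepsilon(T) = 0$ if it has two. The level of $u$ is $L(u) = \min\{d(u,x) : x \in W(T)\}$, and the total level is $L(T) = \sum_{u \in V(T)} L(u)$. -}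

module Defs where

open import Data.Nat as ℕ using (ℕ; zero; suc; _+_; _*_; _∸_; _≤_; _<_; _⊔_; _⊓_; ∣_-_∣; _≡ᵇ_; _≤?_)
open import Data.Nat.ListAction using (sum)
open import Data.Integer as ℤ using (ℤ; +_)
open import Data.Fin using (Fin; zero; suc; fromℕ)
open import Data.List using (List; []; _∷_; map; foldr; allFin; filter; length; concatMap; _∷ʳ_)
open import Data.List.Relation.Unary.All using (All)
open import Data.List.Relation.Unary.Linked using (Linked)
open import Data.List.Relation.Unary.Unique.Propositional using (Unique)
open import Data.Product using (Σ; ∃; ∃-syntax; _×_)
open import Data.Bool using (if_then_else_)
open import Relation.Nullary using (¬_; Dec)
open import Relation.Binary.PropositionalEquality using (_≡_; _≢_)
open import Function.Definitions using (Injective)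

record SimpleGraph (n : ℕ) : Set₁ where
  field
    Adj    : Fin n → Fin n → Set
    sym    : ∀ {u v} → Adj u v → Adj v u
    irrefl : ∀ {u} → ¬ Adj u u
open SimpleGraph public

data Walk {n : ℕ} (G : SimpleGraph n) : Fin n → Fin n → ℕ → Set where
  here : ∀ {u} → Walk G u u 0
  step : ∀ {u w v k} → Adj G u w → Walk G w v k → Walk G u v (suc k)

Connected : ∀ {n} → SimpleGraph n → Set
Connected G = ∀ u v → ∃[ k ] Walk G u v k

IsCycle : ∀ {n} → SimpleGraph n → List (Fin n) → Set
IsCycle G []       = ℕ.zero ≡ suc zero
IsCycle G (x ∷ xs) = (2 ≤ length xs) × Unique (x ∷ xs) × Linked (Adj G) ((x ∷ xs) ∷ʳ x)

Acyclic : ∀ {n} → SimpleGraph n → Set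
Acyclic G = ∀ xs → ¬ IsCycle G xs

IsTree : ∀ {n} → SimpleGraph n → Set
IsTree G = Connected G × Acyclic G

IsDistance : ∀ {n} → SimpleGraph n → (Fin n → Fin n → ℕ) → Set
IsDistance G dist =
  ∀ u v → Walk G u v (dist u v) × (∀ k → Walk G u v k → dist u v ≤ k)

ΣV : ∀ {n} → (Fin n → ℕ) → ℕ
ΣV {n} f = sum (map f (allFin n))

maxL : List ℕ → ℕ
maxL = foldr _⊔_ 0

-- minimum of a nonempty list (junk value 0 for the empty list)
minL : List ℕ → ℕ
minL []       = 0
minL (x ∷ xs) = foldr _⊓_ x xs

pairs : ∀ {n} → List (Fin n × Fin n)
pairs {n} = concatMap (λ u → map (λ v → u Data.Product., v) (allFin n)) (allFin n)

module _ {n : ℕ} (dist : Fin n → Fin n → ℕ) where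

  diam : ℕ
  diam = maxL (map (λ uv → dist (Data.Product.proj₁ uv) (Data.Product.proj₂ uv)) pairs)

  weight : Fin n → ℕ
  weight v = ΣV (λ u → dist u v)

  IsWeightCentre : Fin n → Set
  IsWeightCentre v = All (λ u → weight v ≤ weight u) (allFin n)

  isWeightCentre? : ∀ v → Dec (IsWeightCentre v)
  isWeightCentre? v = Data.List.Relation.Unary.All.all? (λ u → weight v ≤? weight u) (allFin n)

  centres : List (Fin n)
  centres = filter isWeightCentre? (allFin n)

  numCentres : ℕ
  numCentres = length centres

  ε : ℕ
  ε = if numCentres ≡ᵇ 1 then 1 else 0

  level : Fin n → ℕ
  level u = minL (map (dist u) centres)

  totalLevel : ℕ
  totalLevel = ΣV level

  IsRadioLabeling : (Fin n → ℕ) → Set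
  IsRadioLabeling f = ∀ u v → u ≢ v → diam + 1 ≤ dist u v + ∣ f u - f v ∣

  span : (Fin n → ℕ) → ℕ
  span f = maxL (map (λ uv → ∣ f (Data.Product.proj₁ uv) - f (Data.Product.proj₂ uv) ∣) pairs)

  RadioNumberIs : ℤ → Set
  RadioNumberIs r =
    (∃[ f ] IsRadioLabeling f × (+ span f ≡ r)) ×
    (∀ f → IsRadioLabeling f → r ℤ.≤ + span f)

  IsOptimalRadioLabeling : (Fin n → ℕ) → Set
  IsOptimalRadioLabeling f =
    IsRadioLabeling f × (∀ g → IsRadioLabeling g → span f ≤ span g)

-- clamp a natural index into Fin (suc m); only used for indices ≤ m
toIx : (m t : ℕ) → Fin (suc m)
toIx m       zero    = zero
toIx zero    (suc t) = zero
toIx (suc m) (suc t) = suc (toIx m t)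

sumFrom : (ℕ → ℤ) → ℕ → ℕ → ℤ
sumFrom h i zero    = + 0
sumFrom h i (suc k) = h i ℤ.+ sumFrom h (suc i) k

module _ {m : ℕ} (G : SimpleGraph (suc m)) (dist : Fin (suc m) → Fin (suc m) → ℕ)
         (u : Fin (suc m) → Fin (suc m)) where

  -- u_t for t : ℕ (meaningful for t ≤ m)
  at : ℕ → Fin (suc m)
  at t = u (toIx m t)

  first last : Fin (suc m)
  first = u zero
  last  = u (fromℕ m)

  CondA : Set
  CondA =
    (numCentres dist ≡ 1 → IsWeightCentre dist first × Adj G first last) ×
    (numCentres dist ≡ 2 →
       IsWeightCentre dist first × IsWeightCentre dist last × first ≢ last)

  CondB : Set
  CondB = ∀ i j → i < j → j ≤ m →
    ((sumFrom (λ t → + level dist (at t) ℤ.+ + level dist (at (suc t))) i (j ∸ i)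
       ℤ.- (+ (j ∸ i)) ℤ.* (+ (diam dist + ε dist)))
       ℤ.+ + (diam dist + 1))
    ℤ.≤ + dist (at i) (at j)

  labelSeq : ℕ → ℤ
  labelSeq zero    = + 0
  labelSeq (suc i) =
    ((labelSeq i ℤ.- + level dist (at (suc i))) ℤ.- + level dist (at i))
      ℤ.+ + (diam dist + ε dist)

  LabelingOptimal : Set
  LabelingOptimal =
    ∃[ f ] (∀ i → i ≤ m → + f (at i) ≡ labelSeq i) × IsOptimalRadioLabeling dist f

  LinearOrder : Set
  LinearOrder = Injective _≡_ _≡_ u

-- Order the vertices of a tree by the values of a radio labelling f.  The radio condition for two
-- consecutive vertices u_t, u_(t+1), together with d(u,v) ≤ L(u) + L(v) + 1 − ε, forces
-- f(u_(t+1)) − f(u_t) ≥ d + ε − L(u_t) − L(u_(t+1)); summing these gaps gives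
-- span f ≥ (p−1)(d+ε) − 2L(T) + L(u_0) + L(u_(p−1)), and L(u_0) + L(u_(p−1)) ≥ ε.  Equality forces every
-- gap to be tight, which is condition (b), and L(u_0) + L(u_(p−1)) = ε, which is condition (a) once
-- the order is reversed if necessary.  Conversely, under (a) and (b) the labelling of the theorem has
-- all gaps tight and is a radio labelling of exactly that span.  The inequality on d(u,v) comes from
-- the weight centres: in a tree the weight w_T is strictly convex along paths, so there are at most
-- two centres and they are adjacent.

module Submission where

open import Defs hiding (sym)
open import Data.Nat as ℕ using (ℕ; zero; suc; z≤n; s≤s; s≤s⁻¹)
import Data.Nat.Properties as ℕₚ
import Data.List.Properties as Listₚ
open import Data.Nat.ListAction using (sum)
open import Data.Nat.ListAction.Properties using (sum-↭)
open import Data.Integer as ℤ using (ℤ; 0ℤ; +≤+)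
import Data.Integer.Properties as ℤₚ
open import Data.Fin using (Fin; zero; suc; _≟_; toℕ; fromℕ; cast; opposite)
import Data.Fin.Properties as Finₚ
open import Data.List using (List; []; _∷_; _∷ʳ_; _++_; map; allFin; length; tabulate; lookup)
open import Data.List.Membership.Propositional using (_∈_)
open import Data.List.Membership.Propositional.Properties
  using (∈-lookup; ∈-∃++; ∈-map⁺; ∈-map⁻; ∈-filter⁺; ∈-filter⁻; ∈-++⁺ʳ; ∈-allFin; ∈-concatMap⁺)
open import Data.List.Relation.Unary.Any as Any using (here; there)
open import Data.List.Relation.Unary.Any.Properties using (¬Any[])
open import Data.List.Relation.Unary.All as All using (All; []; _∷_)
open import Data.List.Relation.Unary.All.Properties using (∷ʳ⁺)
open import Data.List.Relation.Unary.Linked using (Linked; []; [-]; _∷_)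
open import Data.List.Relation.Unary.AllPairs using ([]; _∷_)
open import Data.List.Relation.Unary.Unique.Propositional using (Unique)
import Data.List.Relation.Unary.Unique.Propositional.Properties as Uniqueₚ
open import Data.List.Extrema.Nat using (argmin; f[argmin]≤f[xs])
open import Data.List.Relation.Binary.Permutation.Propositional using (_↭_; ↭-refl; ↭-prep; ↭-trans; ↭-sym; ↭⇒↭ₛ)
open import Data.List.Relation.Binary.Permutation.Propositional.Properties using (shift; ∈-resp-↭; ↭-length)
import Data.List.Relation.Binary.Permutation.Propositional.Properties as ↭ₚ
import Data.List.Relation.Binary.Permutation.Setoid.Properties as ↭ₛ
open import Function.Definitions using (Injective)
open import Function.Bundles using (_⇔_; mk⇔)
import Relation.Binary.Construct.On as On
open import Data.List.Relation.Unary.Sorted.TotalOrder.Properties using (lookup-mono-≤)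
open import Data.Product using (∃-syntax; _×_; _,_; proj₁; proj₂)
open import Data.Sum using (_⊎_; inj₁; inj₂; [_,_]′)
open import Data.Empty using (⊥; ⊥-elim)
open import Relation.Nullary using (¬_; yes; no; contradiction)
open import Relation.Binary.Definitions using (tri<; tri≈; tri>)
open import Function using (_∘_)
open import Relation.Binary.PropositionalEquality as ≡ using (_≡_; _≢_; refl; cong; cong₂; subst)
module _ {A : Set} where
  open import Data.Nat using (_+_; _≤_)
  open ℕₚ hiding (_≟_)
  open import Algebra.Properties.CommutativeSemigroup +-commutativeSemigroup using (interchange; xy∙z≈xz∙y)

  ≤-maxL : ∀ (g : A → ℕ) {x xs} → x ∈ xs → g x ≤ maxL (map g xs)
  ≤-maxL g (here refl) = m≤m⊔n _ _
  ≤-maxL g (there x∈xs) = ≤-trans (≤-maxL g x∈xs) (m≤n⊔m _ _)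

  maxL-lub : ∀ (g : A → ℕ) xs {k} → (∀ {x} → x ∈ xs → g x ≤ k) → maxL (map g xs) ≤ k
  maxL-lub g []       bound = z≤n
  maxL-lub g (x ∷ xs) bound = ⊔-lub (bound (here refl)) (maxL-lub g xs (bound ∘ there))

  sum-map-+ : ∀ (f g : A → ℕ) xs → sum (map (λ x → f x + g x) xs) ≡ sum (map f xs) + sum (map g xs)
  sum-map-+ f g []       = refl
  sum-map-+ f g (x ∷ xs) = ≡.trans (cong (λ s → f x + g x + s) (sum-map-+ f g xs)) (interchange (f x) (g x) _ _)

  sum-map-mono : ∀ {f g : A → ℕ} xs → (∀ x → f x ≤ g x) → sum (map f xs) ≤ sum (map g xs)
  sum-map-mono []       f≤g = z≤n
  sum-map-mono (x ∷ xs) f≤g = +-mono-≤ (f≤g x) (sum-map-mono xs f≤g)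

  sum-map-mono-at : ∀ {f g : A → ℕ} {x xs} k → x ∈ xs → (∀ y → f y ≤ g y) → f x + k ≤ g x →
                    sum (map f xs) + k ≤ sum (map g xs)
  sum-map-mono-at {f} {g} k (here {xs = xs} refl) f≤g fx+k≤gx =
    ≤-trans (≤-reflexive (xy∙z≈xz∙y (f _) _ k)) (+-mono-≤ fx+k≤gx (sum-map-mono xs f≤g))
  sum-map-mono-at {f} {g} k (there {x = y} x∈xs) f≤g fx+k≤gx =
    ≤-trans (≤-reflexive (+-assoc (f y) _ k)) (+-mono-≤ (f≤g y) (sum-map-mono-at k x∈xs f≤g fx+k≤gx))

minL-∈ : ∀ x xs → minL (x ∷ xs) ∈ x ∷ xs
minL-∈ x []       = here refl
minL-∈ x (y ∷ ys) with ℕₚ.⊓-sel y (minL (x ∷ ys))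
... | inj₁ ≡y = there (here ≡y)
... | inj₂ ≡r with minL-∈ x ys
...   | here r≡x   = here (≡.trans ≡r r≡x)
...   | there r∈ys = there (there (subst (_∈ ys) (≡.sym ≡r) r∈ys))

minL-≤ : ∀ {y xs} → y ∈ xs → minL xs ℕ.≤ y
minL-≤ {xs = x ∷ []}         (here refl)         = ℕₚ.≤-refl
minL-≤ {xs = x ∷ x' ∷ xs}    (here refl)         = ℕₚ.≤-trans (ℕₚ.m⊓n≤n x' _) (minL-≤ {xs = x ∷ xs} (here refl))
minL-≤ {xs = x ∷ x' ∷ xs}    (there (here refl)) = ℕₚ.m⊓n≤m x' _
minL-≤ {xs = x ∷ x' ∷ xs}    (there (there y∈))  = ℕₚ.≤-trans (ℕₚ.m⊓n≤n x' _) (minL-≤ {xs = x ∷ xs} (there y∈))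

linked-∷ʳ : ∀ {A : Set} {R : A → A → Set} xs {x y} → Linked R (xs ∷ʳ x) → R x y → Linked R (xs ∷ʳ x ∷ʳ y)
linked-∷ʳ []           [-]            Rxy = Rxy ∷ [-]
linked-∷ʳ (_ ∷ [])     (Rvw ∷ linked) Rxy = Rvw ∷ linked-∷ʳ [] linked Rxy
linked-∷ʳ (_ ∷ v ∷ vs) (Rvw ∷ linked) Rxy = Rvw ∷ linked-∷ʳ (v ∷ vs) linked Rxy

unique-∷ʳ : ∀ {A : Set} {xs : List A} {y} → Unique xs → All (_≢ y) xs → Unique (xs ∷ʳ y)
unique-∷ʳ []            []          = [] ∷ []
unique-∷ʳ (x∉xs ∷ uniq) (x≢y ∷ xs≢y) = ∷ʳ⁺ x∉xs x≢y ∷ unique-∷ʳ uniq xs≢y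

∈-pairs : ∀ {n} (u v : Fin n) → (u , v) ∈ pairs
∈-pairs {n} u v = ∈-concatMap⁺ _ (Any.map (λ { refl → ∈-map⁺ (u ,_) (∈-allFin v) }) (∈-allFin u))

unique-⊆⇒↭ : ∀ {A : Set} (xs ys : List A) → Unique xs → Unique ys → (∀ {x} → x ∈ xs → x ∈ ys) →
             length ys ℕ.≤ length xs → xs ↭ ys
unique-⊆⇒↭ []       []       _              _    _  _  = ↭-refl
unique-⊆⇒↭ (x ∷ xs) ys       (x∉xs ∷ uniq) uniq' xs⊆ys len with ∈-∃++ (xs⊆ys (here refl))
... | ys₁ , ys₂ , refl = ↭-trans (↭-prep x (unique-⊆⇒↭ xs (ys₁ ++ ys₂) uniq rest-unique rest-⊆ rest-len))
                                 (↭-sym (shift x ys₁ ys₂))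
  where
    moved : ys₁ ++ x ∷ ys₂ ↭ x ∷ ys₁ ++ ys₂
    moved = shift x ys₁ ys₂
    rest-unique : Unique (ys₁ ++ ys₂)
    rest-unique with ↭ₛ.Unique-resp-↭ (≡.setoid _) (↭⇒↭ₛ moved) uniq'
    ... | _ ∷ uniq'' = uniq''
    rest-⊆ : ∀ {z} → z ∈ xs → z ∈ ys₁ ++ ys₂
    rest-⊆ z∈xs with ∈-resp-↭ moved (xs⊆ys (there z∈xs))
    ... | here refl = ⊥-elim (All.lookup x∉xs z∈xs refl)
    ... | there z∈  = z∈
    rest-len : length (ys₁ ++ ys₂) ℕ.≤ length xs
    rest-len = s≤s⁻¹ (ℕₚ.≤-trans (ℕₚ.≤-reflexive (≡.sym (↭-length moved))) len)

unique-lookup-injective : ∀ {A : Set} {xs : List A} → Unique xs → ∀ {i j} → lookup xs i ≡ lookup xs j → i ≡ j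
unique-lookup-injective             (_ ∷ _)    {zero}  {zero}  _  = refl
unique-lookup-injective {xs = _ ∷ _} (x∉ ∷ _)   {zero}  {suc j} eq = ⊥-elim (All.lookup x∉ (∈-lookup j) eq)
unique-lookup-injective {xs = _ ∷ _} (x∉ ∷ _)   {suc i} {zero}  eq = ⊥-elim (All.lookup x∉ (∈-lookup i) (≡.sym eq))
unique-lookup-injective             (_ ∷ uniq) {suc i} {suc j} eq = cong suc (unique-lookup-injective uniq eq)

∣K∸a-K∸b∣≡∣a-b∣ : ∀ {K a b} → a ℕ.≤ K → b ℕ.≤ K → ℕ.∣ (K ℕ.∸ a) - (K ℕ.∸ b) ∣ ≡ ℕ.∣ a - b ∣
∣K∸a-K∸b∣≡∣a-b∣ {K} {a} {b} a≤K b≤K = begin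
  ∣ K ∸ a - K ∸ b ∣                 ≡⟨ ≡.sym (∣m+n-m+o∣≡∣n-o∣ b (K ∸ a) (K ∸ b)) ⟩
  ∣ b + (K ∸ a) - b + (K ∸ b) ∣     ≡⟨ cong₂ ∣_-_∣ (+-comm b (K ∸ a)) (m+[n∸m]≡n b≤K) ⟩
  ∣ (K ∸ a) + b - K ∣               ≡⟨ ∣-∣-comm _ K ⟩
  ∣ K - (K ∸ a) + b ∣               ≡⟨ cong (∣_- (K ∸ a) + b ∣) (≡.sym (m∸n+n≡m a≤K)) ⟩
  ∣ (K ∸ a) + a - (K ∸ a) + b ∣     ≡⟨ ∣m+n-m+o∣≡∣n-o∣ (K ∸ a) a b ⟩
  ∣ a - b ∣                         ∎
  where
    open ≡.≡-Reasoning
    open import Data.Nat using (_+_; _∸_; ∣_-_∣)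
    open ℕₚ hiding (_≟_)

toℕ-toIx : ∀ m t → t ℕ.≤ m → toℕ (toIx m t) ≡ t
toℕ-toIx m       zero    _         = refl
toℕ-toIx (suc m) (suc t) (s≤s t≤m) = cong suc (toℕ-toIx m t t≤m)

toIx-toℕ : ∀ m (k : Fin (suc m)) → toIx m (toℕ k) ≡ k
toIx-toℕ m k = Finₚ.toℕ-injective (toℕ-toIx m (toℕ k) (s≤s⁻¹ (Finₚ.toℕ<n k)))

toIx-injective : ∀ m {i j} → i ℕ.≤ m → j ℕ.≤ m → toIx m i ≡ toIx m j → i ≡ j
toIx-injective m {i} {j} i≤m j≤m eq = ≡.trans (≡.sym (toℕ-toIx m i i≤m)) (≡.trans (cong toℕ eq) (toℕ-toIx m j j≤m))

opposite-toIx : ∀ m t → t ℕ.≤ m → opposite (toIx m t) ≡ toIx m (m ℕ.∸ t)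
opposite-toIx m t t≤m = Finₚ.toℕ-injective (begin
  toℕ (opposite (toIx m t))   ≡⟨ Finₚ.opposite-prop (toIx m t) ⟩
  m ℕ.∸ toℕ (toIx m t)        ≡⟨ cong (m ℕ.∸_) (toℕ-toIx m t t≤m) ⟩
  m ℕ.∸ t                     ≡⟨ ≡.sym (toℕ-toIx m (m ℕ.∸ t) (ℕₚ.m∸n≤m m t)) ⟩
  toℕ (toIx m (m ℕ.∸ t))      ∎)
  where open ≡.≡-Reasoning

toIx-last : ∀ m → toIx m m ≡ fromℕ m
toIx-last m = Finₚ.toℕ-injective (≡.trans (toℕ-toIx m m ℕₚ.≤-refl) (≡.sym (Finₚ.toℕ-fromℕ m)))

module Reindexing {N : ℕ} (u : Fin N → Fin N) (u-injective : Injective _≡_ _≡_ u) where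

  map-allFin-↭ : map u (allFin N) ↭ allFin N
  map-allFin-↭ = unique-⊆⇒↭ _ _ (Uniqueₚ.map⁺ u-injective (Uniqueₚ.allFin⁺ N)) (Uniqueₚ.allFin⁺ N)
                   (λ _ → ∈-allFin _) (ℕₚ.≤-reflexive (≡.sym (Listₚ.length-map u (allFin N))))

  surjective : ∀ v → ∃[ k ] u k ≡ v
  surjective v with ∈-map⁻ u (∈-resp-↭ (↭-sym map-allFin-↭) (∈-allFin v))
  ... | k , _ , v≡uk = k , ≡.sym v≡uk

  ΣV-reindex : ∀ (f : Fin N → ℕ) → ΣV (f ∘ u) ≡ ΣV f
  ΣV-reindex f = ≡.trans (cong sum (Listₚ.map-∘ (allFin N))) (sum-↭ (↭ₚ.map⁺ f map-allFin-↭))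

module Distance {n} (G : SimpleGraph n) (dist : Fin n → Fin n → ℕ) (isDist : IsDistance G dist) where
  open import Data.Nat using (_+_; _≤_; _<_)
  open ℕₚ hiding (_≟_)

  adj-sym : ∀ {u v} → Adj G u v → Adj G v u
  adj-sym = SimpleGraph.sym G

  walk-++ : ∀ {u v w a b} → Walk G u v a → Walk G v w b → Walk G u w (a + b)
  walk-++ here       q = q
  walk-++ (step e p) q = step e (walk-++ p q)

  walk-reverse : ∀ {u v a} → Walk G u v a → Walk G v u a
  walk-reverse here = here
  walk-reverse {a = suc a} (step e p) =
    subst (Walk G _ _) (+-comm a 1) (walk-++ (walk-reverse p) (step (adj-sym e) here))

  geodesic : ∀ u v → Walk G u v (dist u v)
  geodesic u v = proj₁ (isDist u v)

  dist-minimal : ∀ {u v} k → Walk G u v k → dist u v ≤ k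
  dist-minimal = proj₂ (isDist _ _)

  dist-sym : ∀ u v → dist u v ≡ dist v u
  dist-sym u v = ≤-antisym (dist-minimal _ (walk-reverse (geodesic v u)))
                           (dist-minimal _ (walk-reverse (geodesic u v)))

  dist-triangle : ∀ u v w → dist u w ≤ dist u v + dist v w
  dist-triangle u v w = dist-minimal _ (walk-++ (geodesic u v) (geodesic v w))

  dist-refl : ∀ u → dist u u ≡ 0
  dist-refl u = n≤0⇒n≡0 (dist-minimal 0 here)

  dist≡0⇒≡ : ∀ {u v} → dist u v ≡ 0 → u ≡ v
  dist≡0⇒≡ {u} {v} eq with dist u v | geodesic u v
  dist≡0⇒≡ refl | .0 | here = refl

  dist≡1⇒adj : ∀ {u v} → dist u v ≡ 1 → Adj G u v
  dist≡1⇒adj {u} {v} eq with dist u v | geodesic u v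
  dist≡1⇒adj refl | .1 | step e here = e

  adj⇒dist≡1 : ∀ {u v} → Adj G u v → dist u v ≡ 1
  adj⇒dist≡1 {u} {v} e with dist u v | dist-minimal {u} {v} 1 (step e here) | dist≡0⇒≡ {u} {v}
  ... | 0 | _     | ≡u = ⊥-elim (irrefl G (subst (Adj G u) (≡.sym (≡u refl)) e))
  ... | 1 | _     | _  = refl
  ... | suc (suc _) | s≤s () | _

  dist-≤-suc-neighbour : ∀ {x y} z → Adj G x y → dist x z ≤ suc (dist y z)
  dist-≤-suc-neighbour z e = dist-minimal _ (step e (geodesic _ z))

  dist≤diam : ∀ u v → dist u v ≤ diam dist
  dist≤diam u v = ≤-maxL (λ uv → dist (proj₁ uv) (proj₂ uv)) (∈-pairs u v)

  step-towards : ∀ x z → dist x z ≡ 0 ⊎ ∃[ y ] Adj G x y × dist y z < dist x z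
  step-towards x z with dist x z | geodesic x z
  ... | zero  | _                = inj₁ refl
  ... | suc k | step {w = y} e p = inj₂ (y , e , s≤s (dist-minimal k p))

one-vertex⇒diam≡0 : ∀ {G : SimpleGraph 1} {dist} → IsDistance G dist → diam dist ≡ 0
one-vertex⇒diam≡0 {G} {dist} isDist =
  ℕₚ.n≤0⇒n≡0 (maxL-lub (λ uv → dist (proj₁ uv) (proj₂ uv)) pairs
    (λ { {zero , zero} _ → ℕₚ.≤-reflexive (Distance.dist-refl G dist isDist zero)
       ; {suc () , _} _ ; {_ , suc ()} _ }))

diam≥1⇒two-vertices : ∀ m {G : SimpleGraph (suc m)} {dist} → IsDistance G dist → 1 ℕ.≤ diam dist → 1 ℕ.≤ m
diam≥1⇒two-vertices zero    isDist 1≤diam = contradiction (subst (1 ℕ.≤_) (one-vertex⇒diam≡0 isDist) 1≤diam) λ ()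
diam≥1⇒two-vertices (suc m) _      _      = s≤s z≤n

module TreeDistance {n} (G : SimpleGraph n) (dist : Fin n → Fin n → ℕ) (isDist : IsDistance G dist)
                    (acyclic : Acyclic G) where
  open Distance G dist isDist
  open import Data.Nat using (_+_; _≤_; _<_; _≤?_; _<?_)
  open ℕₚ hiding (_≟_)

  IsPath : List (Fin n) → Set
  IsPath xs = Unique xs × Linked (Adj G) xs

  path-not-closable : ∀ {a m ms b} → IsPath (a ∷ (m ∷ ms) ∷ʳ b) → ¬ Adj G b a
  path-not-closable {a} {m} {ms} {b} (uniq , linked) b~a =
    acyclic (a ∷ (m ∷ ms) ∷ʳ b)
      ( s≤s (subst (1 ≤_) (≡.sym (Listₚ.length-++ ms)) (m≤n+m 1 (length ms)))
      , uniq , linked-∷ʳ (a ∷ m ∷ ms) linked b~a)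

  -- An arch over z: a path of at least three vertices whose interior is nowhere closer to z
  -- than its two ends.  Moving the farther end one step towards z keeps it an arch and
  -- lowers the ends, so in a tree no arch exists.
  module Arches (z : Fin n) where
    δ : Fin n → ℕ
    δ x = dist x z

    Above : Fin n → Fin n → Fin n → Set
    Above a b y = δ a ≤ δ y × δ b ≤ δ y

    Arch : Fin n → Fin n → List (Fin n) → Fin n → Set
    Arch a m ms b = IsPath (a ∷ (m ∷ ms) ∷ʳ b) × All (Above a b) (m ∷ ms)

    arch-ends-distinct : ∀ {a m ms b} → Arch a m ms b → a ≢ b
    arch-ends-distinct {m = m} {ms} ((a∉ ∷ _ , _) , _) = All.lookup a∉ (∈-++⁺ʳ (m ∷ ms) (here refl))

    ends-meet-at-z : ∀ {a b} → δ a ≡ 0 → δ b ≤ δ a → a ≡ b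
    ends-meet-at-z {b = b} δa≡0 b≤a =
      ≡.trans (dist≡0⇒≡ δa≡0) (≡.sym (dist≡0⇒≡ (n≤0⇒n≡0 (subst (δ b ≤_) δa≡0 b≤a))))

    lower-left-end : ∀ {a m ms b a'} → Arch a m ms b → Adj G a' a → δ a' < δ a → a' ≢ b → δ b ≤ δ a →
                     Arch a' a (m ∷ ms) b
    lower-left-end {a} {m} {ms} {b} {a'} ((uniq , linked) , above) a'~a a'<a a'≢b b≤a =
      (a'∉ ∷ uniq , a'~a ∷ linked) ,
      (<⇒≤ a'<a , b≤a) ∷ All.map (λ (a≤y , b≤y) → ≤-trans (<⇒≤ a'<a) a≤y , b≤y) above
      where
        below : ∀ {y} → δ a ≤ δ y → a' ≢ y
        below a≤y refl = <⇒≱ a'<a a≤y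
        a'∉ : All (a' ≢_) (a ∷ (m ∷ ms) ∷ʳ b)
        a'∉ = below ≤-refl ∷ ∷ʳ⁺ (All.map (below ∘ proj₁) above) a'≢b

    lower-right-end : ∀ {a m ms b b'} → Arch a m ms b → Adj G b b' → δ b' < δ b → b' ≢ a → δ a ≤ δ b →
                      Arch a m (ms ∷ʳ b) b'
    lower-right-end {a} {m} {ms} {b} {b'} ((uniq , linked) , above) b~b' b'<b b'≢a a≤b =
      (unique-∷ʳ uniq b'∉ , linked-∷ʳ (a ∷ m ∷ ms) linked b~b') ,
      ∷ʳ⁺ (All.map (λ (a≤y , b≤y) → a≤y , ≤-trans (<⇒≤ b'<b) b≤y) above) (a≤b , <⇒≤ b'<b)
      where
        below : ∀ {y} → δ b ≤ δ y → y ≢ b'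
        below b≤y refl = <⇒≱ b'<b b≤y
        b'∉ : All (_≢ b') (a ∷ (m ∷ ms) ∷ʳ b)
        b'∉ = (b'≢a ∘ ≡.sym) ∷ ∷ʳ⁺ (All.map (below ∘ proj₂) above) (below ≤-refl)

    no-arch : ∀ k {a m ms b} → δ a + δ b < k → ¬ Arch a m ms b
    no-arch-lowering-left : ∀ k {a m ms b} → δ a + δ b ≤ k → Arch a m ms b → δ b ≤ δ a → ⊥
    no-arch-lowering-right : ∀ k {a m ms b} → δ a + δ b ≤ k → Arch a m ms b → δ a ≤ δ b → ⊥

    no-arch (suc k) {a} {b = b} (s≤s fuel) arch with δ b ≤? δ a
    ... | yes b≤a = no-arch-lowering-left k fuel arch b≤a
    ... | no  b≰a = no-arch-lowering-right k fuel arch (<⇒≤ (≰⇒> b≰a))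

    no-arch-lowering-left k {a} {b = b} fuel arch b≤a with step-towards a z
    ... | inj₁ δa≡0 = arch-ends-distinct arch (ends-meet-at-z δa≡0 b≤a)
    ... | inj₂ (a' , a~a' , a'<a) with a' ≟ b
    ...   | yes refl = path-not-closable (proj₁ arch) (adj-sym a~a')
    ...   | no a'≢b  = no-arch k (<-≤-trans (+-monoˡ-< (δ b) a'<a) fuel)
                                 (lower-left-end arch (adj-sym a~a') a'<a a'≢b b≤a)

    no-arch-lowering-right k {a} {b = b} fuel arch a≤b with step-towards b z
    ... | inj₁ δb≡0 = arch-ends-distinct arch (≡.sym (ends-meet-at-z δb≡0 a≤b))
    ... | inj₂ (b' , b~b' , b'<b) with b' ≟ a
    ...   | yes refl = path-not-closable (proj₁ arch) b~b'
    ...   | no b'≢a  = no-arch k (<-≤-trans (+-monoʳ-< (δ a) b'<b) fuel)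
                                 (lower-right-end arch b~b' b'<b b'≢a a≤b)

  no-two-lower-neighbours : ∀ z {x a b} → Adj G x a → Adj G x b → a ≢ b →
                            dist a z ≤ dist x z → dist b z ≤ dist x z → ⊥
  no-two-lower-neighbours z {x} {a} {b} x~a x~b a≢b a≤x b≤x =
    Arches.no-arch z _ ≤-refl ((distinct , adj-sym x~a ∷ x~b ∷ [-]) , (a≤x , b≤x) ∷ [])
    where
      distinct : Unique (a ∷ x ∷ b ∷ [])
      distinct = ((λ { refl → irrefl G x~a }) ∷ a≢b ∷ []) ∷ ((λ { refl → irrefl G x~b }) ∷ []) ∷ [] ∷ []

  neighbours-dist-convex : ∀ z {x a b} → Adj G x a → Adj G x b → a ≢ b →
                           dist x z + dist x z ≤ dist a z + dist b z
  neighbours-dist-convex z {x} {a} {b} x~a x~b a≢b with dist x z <? dist a z | dist x z <? dist b z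
  ... | yes x<a | _ = begin
    dist x z + dist x z        ≤⟨ +-monoʳ-≤ (dist x z) (dist-≤-suc-neighbour z x~b) ⟩
    dist x z + suc (dist b z)  ≡⟨ +-suc (dist x z) (dist b z) ⟩
    suc (dist x z) + dist b z  ≤⟨ +-monoˡ-≤ (dist b z) x<a ⟩
    dist a z + dist b z        ∎
    where open ≤-Reasoning
  ... | no _ | yes x<b = begin
    dist x z + dist x z        ≤⟨ +-monoˡ-≤ (dist x z) (dist-≤-suc-neighbour z x~a) ⟩
    suc (dist a z) + dist x z  ≡⟨ ≡.sym (+-suc (dist a z) (dist x z)) ⟩
    dist a z + suc (dist x z)  ≤⟨ +-monoʳ-≤ (dist a z) x<b ⟩
    dist a z + dist b z        ∎
    where open ≤-Reasoning
  ... | no x≮a | no x≮b = ⊥-elim (no-two-lower-neighbours z x~a x~b a≢b (≮⇒≥ x≮a) (≮⇒≥ x≮b))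

module WeightCentres {n} (G : SimpleGraph (suc n)) (dist : Fin (suc n) → Fin (suc n) → ℕ)
                     (isDist : IsDistance G dist) (acyclic : Acyclic G) where
  open Distance G dist isDist
  open TreeDistance G dist isDist acyclic
  open import Data.Nat using (_+_; _≤_)
  open ℕₚ hiding (_≟_)

  w : Fin (suc n) → ℕ
  w = weight dist

  -- Each summand d(u, -) is convex at x, and the summand for u = x even jumps from 0 + 0 to 1 + 1.
  weight-convex : ∀ {x a b} → Adj G x a → Adj G x b → a ≢ b → w x + w x + 2 ≤ w a + w b
  weight-convex {x} {a} {b} x~a x~b a≢b =
    ≡.subst₂ _≤_ (cong (_+ 2) (sum-map-+ (λ u → dist u x) (λ u → dist u x) (allFin _)))
                 (sum-map-+ (λ u → dist u a) (λ u → dist u b) (allFin _))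
      (sum-map-mono-at 2 (∈-allFin x) pointwise at-x)
    where
      pointwise : ∀ u → dist u x + dist u x ≤ dist u a + dist u b
      pointwise u rewrite dist-sym u x | dist-sym u a | dist-sym u b = neighbours-dist-convex u x~a x~b a≢b
      at-x : dist x x + dist x x + 2 ≤ dist x a + dist x b
      at-x rewrite dist-refl x | adj⇒dist≡1 x~a | adj⇒dist≡1 x~b = ≤-refl

  weight-step-on-geodesic : ∀ {a a₁ a₂ b k} → Adj G a a₁ → Adj G a₁ a₂ → Walk G a₂ b k →
                            suc (suc k) ≡ dist a b → w a ≤ w a₁ → w a₁ + 2 ≤ w a₂
  weight-step-on-geodesic {a} {a₁} {a₂} {k = k} a~a₁ a₁~a₂ p geo a≤a₁ =
    +-cancelˡ-≤ (w a₁) _ _ (begin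
      w a₁ + (w a₁ + 2)  ≡⟨ ≡.sym (+-assoc (w a₁) (w a₁) 2) ⟩
      w a₁ + w a₁ + 2    ≤⟨ weight-convex (adj-sym a~a₁) a₁~a₂ a≢a₂ ⟩
      w a + w a₂         ≤⟨ +-monoˡ-≤ (w a₂) a≤a₁ ⟩
      w a₁ + w a₂        ∎)
    where
      open ≤-Reasoning
      a≢a₂ : a ≢ a₂
      a≢a₂ refl = 1+n≰n (≤-trans (≤-trans (≤-reflexive geo) (dist-minimal k p)) (n≤1+n k))

  weight-grows-along-geodesic : ∀ {a a₁ a₂ b k} → Adj G a a₁ → Adj G a₁ a₂ → Walk G a₂ b k →
                                suc (suc k) ≡ dist a b → w a ≤ w a₁ → w a₁ + 2 ≤ w b
  weight-grows-along-geodesic a~a₁ a₁~a₂ here geo a≤a₁ = weight-step-on-geodesic a~a₁ a₁~a₂ here geo a≤a₁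
  weight-grows-along-geodesic {a} {a₁} {a₂} {b} {suc k} a~a₁ a₁~a₂ (step a₂~a₃ p) geo a≤a₁ =
    ≤-trans a₁+2≤a₂ (≤-trans (m≤m+n (w a₂) 2)
      (weight-grows-along-geodesic a₁~a₂ a₂~a₃ p geo₁ (≤-trans (m≤m+n (w a₁) 2) a₁+2≤a₂)))
    where
      a₁+2≤a₂ : w a₁ + 2 ≤ w a₂
      a₁+2≤a₂ = weight-step-on-geodesic a~a₁ a₁~a₂ (step a₂~a₃ p) geo a≤a₁
      geo₁ : suc (suc k) ≡ dist a₁ b
      geo₁ = ≤-antisym (s≤s⁻¹ (≤-trans (≤-reflexive geo) (dist-≤-suc-neighbour b a~a₁)))
                       (dist-minimal _ (step a₁~a₂ (step a₂~a₃ p)))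

  centre-minimal : ∀ {c} → IsWeightCentre dist c → ∀ u → w c ≤ w u
  centre-minimal cc u = All.lookup cc (∈-allFin u)

  centres-adjacent : ∀ {c c'} → IsWeightCentre dist c → IsWeightCentre dist c' → c ≢ c' → Adj G c c'
  centres-adjacent {c} {c'} cc cc' c≢c' with dist c c' in eq | geodesic c c'
  ... | 0           | _                        = ⊥-elim (c≢c' (dist≡0⇒≡ eq))
  ... | 1           | _                        = dist≡1⇒adj eq
  ... | suc (suc k) | step {w = a₁} c~a₁ (step a₁~a₂ p) =
    ⊥-elim (m+1+n≰m (w a₁) (begin
      w a₁ + 2  ≤⟨ weight-grows-along-geodesic c~a₁ a₁~a₂ p (≡.sym eq) (centre-minimal cc a₁) ⟩
      w c'      ≤⟨ centre-minimal cc' c ⟩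
      w c       ≤⟨ centre-minimal cc a₁ ⟩
      w a₁      ∎))
    where open ≤-Reasoning

  centre-exists : ∃[ c ] IsWeightCentre dist c
  centre-exists = argmin w zero (allFin _) , f[argmin]≤f[xs] {f = w} zero (allFin _)

  ∈-centres⁺ : ∀ {c} → IsWeightCentre dist c → c ∈ centres dist
  ∈-centres⁺ cc = ∈-filter⁺ (isWeightCentre? dist) (∈-allFin _) cc

  ∈-centres⁻ : ∀ {c} → c ∈ centres dist → IsWeightCentre dist c
  ∈-centres⁻ c∈ = proj₂ (∈-filter⁻ (isWeightCentre? dist) c∈)

  centres-unique : Unique (centres dist)
  centres-unique = Uniqueₚ.filter⁺ (isWeightCentre? dist) (Uniqueₚ.allFin⁺ _)

  adjacent-members : ∀ {cs} → centres dist ≡ cs → ∀ {x y} → x ∈ cs → y ∈ cs → x ≢ y → Adj G x y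
  adjacent-members eq x∈ y∈ = centres-adjacent (∈-centres⁻ (subst (_ ∈_) (≡.sym eq) x∈))
                                               (∈-centres⁻ (subst (_ ∈_) (≡.sym eq) y∈))

  data CentreSet : Set where
    one : ∀ c → centres dist ≡ c ∷ [] → CentreSet
    two : ∀ c c' → centres dist ≡ c ∷ c' ∷ [] → Adj G c c' → CentreSet

  classify-centres : CentreSet
  classify-centres with centres dist in eq
  ... | [] = ⊥-elim (¬Any[] (subst (proj₁ centre-exists ∈_) eq (∈-centres⁺ (proj₂ centre-exists))))
  ... | c ∷ [] = one c eq
  ... | c ∷ c' ∷ [] with subst Unique eq centres-unique
  ...   | (c≢c' ∷ []) ∷ _ = two c c' eq (adjacent-members eq (here refl) (there (here refl)) c≢c')
  classify-centres | c ∷ c' ∷ c'' ∷ cs with subst Unique eq centres-unique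
  ...   | (c≢c' ∷ c≢c'' ∷ _) ∷ (c'≢c'' ∷ _) ∷ _ =
    ⊥-elim (acyclic (c ∷ c' ∷ c'' ∷ [])
      ( s≤s (s≤s z≤n)
      , (c≢c' ∷ c≢c'' ∷ []) ∷ (c'≢c'' ∷ []) ∷ [] ∷ []
      , adjacent-members eq (here refl) (there (here refl)) c≢c'
      ∷ adjacent-members eq (there (here refl)) (there (there (here refl))) c'≢c''
      ∷ adjacent-members eq (there (there (here refl))) (here refl) (c≢c'' ∘ ≡.sym) ∷ [-]))

module Levels {n} (G : SimpleGraph (suc n)) (dist : Fin (suc n) → Fin (suc n) → ℕ)
              (isDist : IsDistance G dist) (acyclic : Acyclic G) where
  open Distance G dist isDist
  open WeightCentres G dist isDist acyclic
  open import Data.Nat using (_+_; _≤_; _≡ᵇ_)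
  open import Data.Nat.Tactic.RingSolver using (solve-∀)
  open import Data.Bool using (if_then_else_)
  open ℕₚ renaming (_≟_ to _≟ℕ_)

  L : Fin (suc n) → ℕ
  L = level dist

  EndsCondition : Fin (suc n) → Fin (suc n) → Set
  EndsCondition a b =
    (numCentres dist ≡ 1 → IsWeightCentre dist a × Adj G a b) ×
    (numCentres dist ≡ 2 → IsWeightCentre dist a × IsWeightCentre dist b × a ≢ b)

  ε-of : ∀ {cs} → centres dist ≡ cs → ε dist ≡ (if length cs ≡ᵇ 1 then 1 else 0)
  ε-of = cong (λ cs → if length cs ≡ᵇ 1 then 1 else 0)

  ε≤1 : ε dist ≤ 1
  ε≤1 with classify-centres
  ... | one c eq      = ≤-reflexive (ε-of eq)
  ... | two c c' eq _ = ≤-trans (≤-reflexive (ε-of eq)) z≤n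

  only-centre : ∀ {c x} → centres dist ≡ c ∷ [] → IsWeightCentre dist x → x ≡ c
  only-centre eq cx with subst (_ ∈_) eq (∈-centres⁺ cx)
  ... | here x≡c = x≡c

  distinct-centres⇒ε≡0 : ∀ {x y} → IsWeightCentre dist x → IsWeightCentre dist y → x ≢ y → ε dist ≡ 0
  distinct-centres⇒ε≡0 cx cy x≢y with classify-centres
  ... | one c eq      = ⊥-elim (x≢y (≡.trans (only-centre eq cx) (≡.sym (only-centre eq cy))))
  ... | two c c' eq _ = ε-of eq

  centres-close : ∀ {x y} → IsWeightCentre dist x → IsWeightCentre dist y → dist x y + ε dist ≤ 1
  centres-close {x} {y} cx cy with x ≟ y
  ... | yes refl = subst (λ d → d + ε dist ≤ 1) (≡.sym (dist-refl x)) ε≤1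
  ... | no x≢y   = ≤-reflexive (cong₂ _+_ (adj⇒dist≡1 (centres-adjacent cx cy x≢y)) (distinct-centres⇒ε≡0 cx cy x≢y))

  centres-nonempty : ∃[ c ] ∃[ cs ] centres dist ≡ c ∷ cs
  centres-nonempty with classify-centres
  ... | one c eq      = c , [] , eq
  ... | two c c' eq _ = c , c' ∷ [] , eq

  level-attained : ∀ u → ∃[ x ] IsWeightCentre dist x × L u ≡ dist u x
  level-attained u with centres-nonempty
  ... | c , cs , eq with ∈-map⁻ (dist u) (minL-∈ (dist u c) (map (dist u) cs))
  ...   | x , x∈ , min≡ = x , ∈-centres⁻ (subst (x ∈_) (≡.sym eq) x∈) ,
                          ≡.trans (cong (λ cs → minL (map (dist u) cs)) eq) min≡

  level≡0⇒centre : ∀ {u} → L u ≡ 0 → IsWeightCentre dist u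
  level≡0⇒centre {u} Lu≡0 =
    subst (IsWeightCentre dist) (≡.sym (dist≡0⇒≡ (≡.trans (≡.sym (proj₂ (proj₂ attained))) Lu≡0)))
          (proj₁ (proj₂ attained))
    where
      attained : ∃[ x ] IsWeightCentre dist x × L u ≡ dist u x
      attained = level-attained u

  centre⇒level≡0 : ∀ {u} → IsWeightCentre dist u → L u ≡ 0
  centre⇒level≡0 {u} cu = n≤0⇒n≡0 (≤-trans (minL-≤ (∈-map⁺ (dist u) (∈-centres⁺ cu))) (≤-reflexive (dist-refl u)))

  one-centre⇒level≡dist : ∀ {c a b} → centres dist ≡ c ∷ [] → IsWeightCentre dist a → L b ≡ dist a b
  one-centre⇒level≡dist {a = a} {b} eq ca with level-attained b
  ... | x , cx , Lb≡ = ≡.trans Lb≡ (≡.trans (cong (dist b) (≡.trans (only-centre eq cx) (≡.sym (only-centre eq ca))))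
                                            (dist-sym b a))

  dist+ε≤levels+1 : ∀ u v → dist u v + ε dist ≤ L u + L v + 1
  dist+ε≤levels+1 u v with level-attained u | level-attained v
  ... | x , cx , Lu≡ | y , cy , Lv≡ = begin
    dist u v + ε dist                            ≤⟨ +-monoˡ-≤ (ε dist) (dist-triangle u x v) ⟩
    dist u x + dist x v + ε dist                 ≤⟨ +-monoˡ-≤ (ε dist) (+-monoʳ-≤ (dist u x) (dist-triangle x y v)) ⟩
    dist u x + (dist x y + dist y v) + ε dist    ≡⟨ regroup (dist u x) (dist x y) (dist y v) (ε dist) ⟩
    dist u x + dist y v + (dist x y + ε dist)    ≤⟨ +-monoʳ-≤ (dist u x + dist y v) (centres-close cx cy) ⟩
    dist u x + dist y v + 1
      ≡⟨ cong₂ (λ a b → a + b + 1) (≡.sym Lu≡) (≡.trans (dist-sym y v) (≡.sym Lv≡)) ⟩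
    L u + L v + 1                                ∎
    where
      open ≤-Reasoning
      regroup : ∀ a b c d → a + (b + c) + d ≡ a + c + (b + d)
      regroup = solve-∀

  ε≤levels : ∀ {u v} → u ≢ v → ε dist ≤ L u + L v
  ε≤levels {u} {v} u≢v with L u ≟ℕ 0 | L v ≟ℕ 0
  ... | yes Lu≡0 | yes Lv≡0 =
    ≤-trans (≤-reflexive (distinct-centres⇒ε≡0 (level≡0⇒centre Lu≡0) (level≡0⇒centre Lv≡0) u≢v)) z≤n
  ... | no Lu≢0  | _        = ≤-trans ε≤1 (≤-trans (n≢0⇒n>0 Lu≢0) (m≤m+n (L u) (L v)))
  ... | yes _    | no Lv≢0  = ≤-trans ε≤1 (≤-trans (n≢0⇒n>0 Lv≢0) (m≤n+m (L v) (L u)))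

  levels≡ε⇒level≡0 : ∀ {a b} → L a + L b ≡ ε dist → L a ≡ 0 ⊎ L b ≡ 0
  levels≡ε⇒level≡0 {a} {b} sum with L a | L b
  ... | 0     | _     = inj₁ refl
  ... | suc _ | 0     = inj₂ refl
  ... | suc x | suc y with m+n≤o⇒n≤o x (s≤s⁻¹ (≤-trans (≤-reflexive sum) ε≤1))
  ...   | ()

  ends-condition⇒levels≡ε : ∀ {a b} → EndsCondition a b → L a + L b ≡ ε dist
  ends-condition⇒levels≡ε {a} {b} (one-centre , two-centres) with classify-centres
  ... | one c eq with one-centre (cong length eq)
  ...   | ca , a~b = ≡.trans (cong₂ _+_ (centre⇒level≡0 ca)
                                      (≡.trans (one-centre⇒level≡dist eq ca) (adj⇒dist≡1 a~b)))
                             (≡.sym (ε-of eq))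
  ends-condition⇒levels≡ε (one-centre , two-centres) | two c c' eq _ with two-centres (cong length eq)
  ...   | ca , cb , _ = ≡.trans (cong₂ _+_ (centre⇒level≡0 ca) (centre⇒level≡0 cb)) (≡.sym (ε-of eq))

  levels≡ε⇒ends-condition : ∀ {a b} → a ≢ b → L a ≡ 0 → L a + L b ≡ ε dist → EndsCondition a b
  levels≡ε⇒ends-condition {a} {b} a≢b La≡0 sum with classify-centres
  ... | one c eq = (λ _ → ca , a~b) , λ #≡2 → ⊥-elim (1+n≢n (≡.trans (≡.sym #≡2) (cong length eq)))
    where
      ca : IsWeightCentre dist a
      ca = level≡0⇒centre La≡0
      a~b : Adj G a b
      a~b = dist≡1⇒adj (≡.trans (≡.sym (one-centre⇒level≡dist eq ca))
                                 (≡.trans (≡.sym (cong (_+ L b) La≡0)) (≡.trans sum (ε-of eq))))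
  ... | two c c' eq _ =
    (λ #≡1 → ⊥-elim (1+n≢n (≡.trans (≡.sym (cong length eq)) #≡1))) ,
    λ _ → level≡0⇒centre La≡0 ,
          level≡0⇒centre (≡.trans (≡.sym (cong (_+ L b) La≡0)) (≡.trans sum (ε-of eq))) , a≢b

module IntegerSums where
  open import Data.Integer using (+_; _+_; _-_; _*_; _≤_)
  open import Data.Integer.Tactic.RingSolver using (solve-∀)
  open ℤₚ
  open import Algebra.Properties.CommutativeSemigroup +-commutativeSemigroup using (interchange)

  ≤-by-difference : ∀ {x y d} → 0ℤ ≤ d → y - x ≡ d → x ≤ y
  ≤-by-difference 0≤d eq = 0≤i-j⇒j≤i (subst (0ℤ ≤_) (≡.sym eq) 0≤d)

  nonneg-sum≤0 : ∀ {x y} → 0ℤ ≤ x → 0ℤ ≤ y → x + y ≤ 0ℤ → x ≡ 0ℤ × y ≡ 0ℤ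
  nonneg-sum≤0 {x} {y} 0≤x 0≤y x+y≤0 =
    ≤-antisym (≤-trans (≤-trans (≤-reflexive (≡.sym (+-identityʳ x))) (+-monoʳ-≤ x 0≤y)) x+y≤0) 0≤x ,
    ≤-antisym (≤-trans (≤-trans (≤-reflexive (≡.sym (+-identityˡ y))) (+-monoˡ-≤ y 0≤x)) x+y≤0) 0≤y

  +∣m-n∣≡+n-+m : ∀ {m n} → m ℕ.≤ n → + ℕ.∣ m - n ∣ ≡ + n - + m
  +∣m-n∣≡+n-+m {m} {n} m≤n =
    ≡.trans (cong +_ (ℕₚ.m≤n⇒∣m-n∣≡n∸m m≤n)) (≡.sym (≡.trans ([+m]-[+n]≡m⊖n n m) (≤-⊖ m≤n)))

  monotone-from-steps : ∀ (X : ℕ → ℤ) {m} → (∀ t → t ℕ.< m → X t ≤ X (suc t)) →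
                        ∀ {i j} → i ℕ.≤ j → j ℕ.≤ m → X i ≤ X j
  monotone-from-steps X steps {j = zero}  z≤n _ = ≤-refl
  monotone-from-steps X steps {j = suc j} i≤j j<m with ℕₚ.m≤n⇒m<n∨m≡n i≤j
  ... | inj₂ refl      = ≤-refl
  ... | inj₁ (s≤s i≤j) = ≤-trans (monotone-from-steps X steps i≤j (ℕₚ.<⇒≤ j<m)) (steps j j<m)

  sumFrom-+ : ∀ (a b : ℕ → ℤ) i k → sumFrom (λ t → a t + b t) i k ≡ sumFrom a i k + sumFrom b i k
  sumFrom-+ a b i zero    = refl
  sumFrom-+ a b i (suc k) = ≡.trans (cong (λ s → a i + b i + s) (sumFrom-+ a b (suc i) k)) (interchange (a i) (b i) _ _)

  sumFrom-shift : ∀ (a : ℕ → ℤ) i k → sumFrom (a ∘ suc) i k ≡ sumFrom a (suc i) k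
  sumFrom-shift a i zero    = refl
  sumFrom-shift a i (suc k) = cong (λ s → a (suc i) + s) (sumFrom-shift a (suc i) k)

  sumFrom-∷ʳ : ∀ (a : ℕ → ℤ) i k → sumFrom a i (suc k) ≡ sumFrom a i k + a (i ℕ.+ k)
  sumFrom-∷ʳ a i zero    =
    ≡.trans (+-identityʳ (a i)) (≡.trans (cong a (≡.sym (ℕₚ.+-identityʳ i))) (≡.sym (+-identityˡ _)))
  sumFrom-∷ʳ a i (suc k) = begin
    a i + sumFrom a (suc i) (suc k)             ≡⟨ cong (λ s → a i + s) (sumFrom-∷ʳ a (suc i) k) ⟩
    a i + (sumFrom a (suc i) k + a (suc i ℕ.+ k)) ≡⟨ ≡.sym (+-assoc (a i) _ _) ⟩
    a i + sumFrom a (suc i) k + a (suc i ℕ.+ k)   ≡⟨ cong (λ j → a i + sumFrom a (suc i) k + a j) (≡.sym (ℕₚ.+-suc i k)) ⟩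
    a i + sumFrom a (suc i) k + a (i ℕ.+ suc k)   ∎
    where open ≡.≡-Reasoning

  sumFrom-adjacent-pairs : ∀ (a : ℕ → ℤ) m →
    sumFrom (λ t → a t + a (suc t)) 0 m ≡ (sumFrom a 0 (suc m) - a m) + (sumFrom a 0 (suc m) - a 0)
  sumFrom-adjacent-pairs a m = begin
    sumFrom (λ t → a t + a (suc t)) 0 m                          ≡⟨ sumFrom-+ a (a ∘ suc) 0 m ⟩
    sumFrom a 0 m + sumFrom (a ∘ suc) 0 m                         ≡⟨ cong (λ s → sumFrom a 0 m + s) (sumFrom-shift a 0 m) ⟩
    sumFrom a 0 m + sumFrom a 1 m                                 ≡⟨ regroup (sumFrom a 0 m) (sumFrom a 1 m) (a 0) (a m) ⟩
    (sumFrom a 0 m + a m - a m) + (a 0 + sumFrom a 1 m - a 0)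
      ≡⟨ cong (λ s → (s - a m) + (a 0 + sumFrom a 1 m - a 0)) (≡.sym (sumFrom-∷ʳ a 0 m)) ⟩
    (sumFrom a 0 (suc m) - a m) + (sumFrom a 0 (suc m) - a 0)     ∎
    where
      open ≡.≡-Reasoning
      regroup : ∀ s s' a₀ aₘ → s + s' ≡ (s + aₘ - aₘ) + (a₀ + s' - a₀)
      regroup = solve-∀

  slack : (ℕ → ℤ) → ℤ → (ℕ → ℤ) → ℕ → ℤ
  slack X c h t = X (suc t) - X t - c + h t

  telescope : ∀ (X : ℕ → ℤ) c h i k →
              X (i ℕ.+ k) ≡ X i + + k * c - sumFrom h i k + sumFrom (slack X c h) i k
  telescope X c h i zero    = ≡.trans (cong X (ℕₚ.+-identityʳ i)) (no-steps (X i) c)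
    where
      no-steps : ∀ x c → x ≡ x + + 0 * c - + 0 + + 0
      no-steps = solve-∀
  telescope X c h i (suc k) = begin
    X (i ℕ.+ suc k)  ≡⟨ cong X (ℕₚ.+-suc i k) ⟩
    X (suc i ℕ.+ k)  ≡⟨ telescope X c h (suc i) k ⟩
    X (suc i) + + k * c - sumFrom h (suc i) k + sumFrom (slack X c h) (suc i) k
      ≡⟨ one-more-step (X i) (X (suc i)) (+ k) c (h i) (sumFrom h (suc i) k) (sumFrom (slack X c h) (suc i) k) ⟩
    X i + + suc k * c - sumFrom h i (suc k) + sumFrom (slack X c h) i (suc k)  ∎
    where
      open ≡.≡-Reasoning
      one-more-step : ∀ x x' k c hᵢ H S →
        x' + k * c - H + S ≡ x + (+ 1 + k) * c - (hᵢ + H) + ((x' - x - c + hᵢ) + S)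
      one-more-step = solve-∀

  below-suc⇒below : ∀ {P : ℕ → Set} k → (∀ t → t ℕ.< suc k → P t) → ∀ t → t ℕ.< k → P t
  below-suc⇒below k P<1+k t t<k = P<1+k t (ℕₚ.m<n⇒m<1+n t<k)

  sumFrom-nonneg : ∀ (d : ℕ → ℤ) k → (∀ t → t ℕ.< k → 0ℤ ≤ d t) → 0ℤ ≤ sumFrom d 0 k
  sumFrom-nonneg d zero    _      = ≤-refl
  sumFrom-nonneg d (suc k) nonneg = subst (0ℤ ≤_) (≡.sym (sumFrom-∷ʳ d 0 k))
    (+-mono-≤ (sumFrom-nonneg d k (below-suc⇒below k nonneg)) (nonneg k ℕₚ.≤-refl))

  sumFrom-nonneg-≤0 : ∀ (d : ℕ → ℤ) k → (∀ t → t ℕ.< k → 0ℤ ≤ d t) → sumFrom d 0 k ≤ 0ℤ →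
                      ∀ t → t ℕ.< k → d t ≡ 0ℤ
  sumFrom-nonneg-≤0 d (suc k) nonneg sum≤0 t t<1+k
    with nonneg-sum≤0 (sumFrom-nonneg d k (below-suc⇒below k nonneg)) (nonneg k ℕₚ.≤-refl)
                      (subst (_≤ 0ℤ) (sumFrom-∷ʳ d 0 k) sum≤0)
       | ℕₚ.m≤n⇒m<n∨m≡n (s≤s⁻¹ t<1+k)
  ... | init≡0 , _    | inj₁ t<k  = sumFrom-nonneg-≤0 d k (below-suc⇒below k nonneg) (≤-reflexive init≡0) t t<k
  ... | _      , dk≡0 | inj₂ refl = dk≡0

  sumFrom-zero : ∀ (d : ℕ → ℤ) i k → (∀ t → t ℕ.< i ℕ.+ k → d t ≡ 0ℤ) → sumFrom d i k ≡ 0ℤ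
  sumFrom-zero d i zero    _     = refl
  sumFrom-zero d i (suc k) zeros =
    cong₂ _+_ (zeros i (ℕₚ.m<m+n i (s≤s z≤n)))
              (sumFrom-zero d (suc i) k (λ t t< → zeros t (subst (t ℕ.<_) (≡.sym (ℕₚ.+-suc i k)) t<)))

  +sum-tabulate : ∀ m (f : Fin (suc m) → ℕ) → + sum (tabulate f) ≡ sumFrom (λ t → + f (toIx m t)) 0 (suc m)
  +sum-tabulate zero    f = refl
  +sum-tabulate (suc m) f =
    cong (λ s → + f zero + s) (≡.trans (+sum-tabulate m (f ∘ suc)) (sumFrom-shift (λ t → + f (toIx (suc m) t)) 0 (suc m)))

  +ΣV≡sumFrom : ∀ m (f : Fin (suc m) → ℕ) → + ΣV f ≡ sumFrom (λ t → + f (toIx m t)) 0 (suc m)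
  +ΣV≡sumFrom m f = ≡.trans (cong (+_ ∘ sum) (Listₚ.map-tabulate (λ i → i) f)) (+sum-tabulate m f)

module RadioNumber (m : ℕ) (G : SimpleGraph (suc m)) (acyclic : Acyclic G)
                   (dist : Fin (suc m) → Fin (suc m) → ℕ) (isDist : IsDistance G dist) where
  open Distance G dist isDist
  open Levels G dist isDist acyclic
  open IntegerSums
  open import Data.Integer using (+_; _+_; _-_; _*_; _≤_)
  open import Data.Integer.Tactic.RingSolver using (solve-∀)
  open ℤₚ using (≤-refl; ≤-trans; ≤-reflexive; +-mono-≤; i≤j⇒0≤j-i; 0≤i-j⇒j≤i; i≡j⇒i-j≡0; i-j≡0⇒i≡j;
                 drop‿+≤+; 0≤i⇒+∣i∣≡i)

  D : ℕ
  D = diam dist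

  c : ℕ
  c = D ℕ.+ ε dist

  -- With p = m + 1 vertices this is (p − 1)(d + ε) − 2L(T) + ε.
  rnBound : ℤ
  rnBound = + m * + c - + 2 * + totalLevel dist + + ε dist

  AdmissibleOrder : Set
  AdmissibleOrder = ∃[ u ] LinearOrder G dist u × CondA G dist u × CondB G dist u

  module Order (u : Fin (suc m) → Fin (suc m)) where
    vertex : ℕ → Fin (suc m)
    vertex = at G dist u

    ℓ : ℕ → ℕ
    ℓ t = L (vertex t)

    pairLevel : ℕ → ℤ
    pairLevel t = + ℓ t + + ℓ (suc t)

    last≡vertex-m : last G dist u ≡ vertex m
    last≡vertex-m = cong u (≡.sym (toIx-last m))

    vertex-injective : Injective _≡_ _≡_ u → ∀ {i j} → i ℕ.≤ m → j ℕ.≤ m → vertex i ≡ vertex j → i ≡ j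
    vertex-injective u-inj i≤m j≤m eq = toIx-injective m i≤m j≤m (u-inj eq)

    sum-pairLevel : Injective _≡_ _≡_ u →
                    sumFrom pairLevel 0 m ≡ (+ totalLevel dist - + ℓ m) + (+ totalLevel dist - + ℓ 0)
    sum-pairLevel u-inj = ≡.trans (sumFrom-adjacent-pairs (λ t → + ℓ t) m)
                                  (cong (λ S → (S - + ℓ m) + (S - + ℓ 0)) levels-sum)
      where
        levels-sum : sumFrom (λ t → + ℓ t) 0 (suc m) ≡ + totalLevel dist
        levels-sum = ≡.trans (≡.sym (+ΣV≡sumFrom m (L ∘ u))) (cong +_ (Reindexing.ΣV-reindex u u-inj L))

    condB-bound : ℕ → ℕ → ℤ
    condB-bound i j = (sumFrom pairLevel i (j ℕ.∸ i) - + (j ℕ.∸ i) * + c) + + (D ℕ.+ 1)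

    TightLabels : (ℕ → ℤ) → Set
    TightLabels X = ∀ i k → i ℕ.+ k ℕ.≤ m → X (i ℕ.+ k) ≡ X i + + k * + c - sumFrom pairLevel i k

    -- For tight labels, condition (b) for i, j is the radio condition for u_i, u_j.
    condB-slack≡radio-slack : ∀ {X} → TightLabels X → ∀ {i j} → i ℕ.≤ j → j ℕ.≤ m →
      + dist (vertex i) (vertex j) - condB-bound i j ≡ (+ dist (vertex i) (vertex j) + (X j - X i)) - + (D ℕ.+ 1)
    condB-slack≡radio-slack {X} tightX {i} {j} i≤j j≤m = begin
      + d - condB-bound i j
        ≡⟨ regroup (+ d) (X i) (+ k) (+ c) (sumFrom pairLevel i k) (+ D) ⟩
      (+ d + (X i + + k * + c - sumFrom pairLevel i k - X i)) - + (D ℕ.+ 1)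
        ≡⟨ cong (λ x → (+ d + (x - X i)) - + (D ℕ.+ 1)) (≡.sym Xj≡) ⟩
      (+ d + (X j - X i)) - + (D ℕ.+ 1)  ∎
      where
        open ≡.≡-Reasoning
        d = dist (vertex i) (vertex j)
        k = j ℕ.∸ i
        i+k≡j : i ℕ.+ k ≡ j
        i+k≡j = ℕₚ.m+[n∸m]≡n i≤j
        Xj≡ : X j ≡ X i + + k * + c - sumFrom pairLevel i k
        Xj≡ = ≡.trans (cong X (≡.sym i+k≡j)) (tightX i k (subst (ℕ._≤ m) (≡.sym i+k≡j) j≤m))
        regroup : ∀ d x k c S D → d - ((S - k * c) + (D + + 1)) ≡ (d + (x + k * c - S - x)) - (D + + 1)
        regroup = solve-∀

  module LowerBound (m≥1 : 1 ℕ.≤ m) (u : Fin (suc m) → Fin (suc m)) (u-inj : Injective _≡_ _≡_ u)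
                    (g : Fin (suc m) → ℕ) (g-radio : IsRadioLabeling dist g)
                    (g-step : ∀ t → t ℕ.< m → g (at G dist u t) ℕ.≤ g (at G dist u (suc t))) where
    open Order u

    X : ℕ → ℤ
    X t = + g (vertex t)

    gap : ℕ → ℤ
    gap = slack X (+ c) pairLevel

    X-monotone : ∀ {i j} → i ℕ.≤ j → j ℕ.≤ m → X i ≤ X j
    X-monotone = monotone-from-steps X (λ t t<m → +≤+ (g-step t t<m))

    label-difference : ∀ {i j} → i ℕ.≤ j → j ℕ.≤ m → + ℕ.∣ g (vertex i) - g (vertex j) ∣ ≡ X j - X i
    label-difference i≤j j≤m = +∣m-n∣≡+n-+m (drop‿+≤+ (X-monotone i≤j j≤m))

    radio-along : ∀ {i j} → i ℕ.< j → j ℕ.≤ m → + (D ℕ.+ 1) ≤ + dist (vertex i) (vertex j) + (X j - X i)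
    radio-along {i} {j} i<j j≤m =
      subst (λ x → + (D ℕ.+ 1) ≤ + dist (vertex i) (vertex j) + x) (label-difference (ℕₚ.<⇒≤ i<j) j≤m)
        (+≤+ (g-radio (vertex i) (vertex j)
                      (ℕₚ.<⇒≢ i<j ∘ vertex-injective u-inj (ℕₚ.≤-trans (ℕₚ.<⇒≤ i<j) j≤m) j≤m)))

    -- The radio condition for u_t, u_(t+1) plus d(u,v) + ε ≤ L u + L v + 1 is gap t ≥ 0.
    gap≥0 : ∀ t → t ℕ.< m → 0ℤ ≤ gap t
    gap≥0 t t<m = ≤-by-difference
      (+-mono-≤ (i≤j⇒0≤j-i (radio-along (ℕₚ.n<1+n t) t<m))
                (i≤j⇒0≤j-i (+≤+ (dist+ε≤levels+1 (vertex t) (vertex (suc t))))))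
      (regroup (X t) (X (suc t)) (+ D) (+ ε dist) (+ dist (vertex t) (vertex (suc t))) (+ ℓ t) (+ ℓ (suc t)))
      where
        regroup : ∀ x x' D E d a b →
          x' - x - (D + E) + (a + b) - 0ℤ ≡ ((d + (x' - x)) - (D + + 1)) + ((a + b + + 1) - (d + E))
        regroup = solve-∀

    span-decomposition : X m - X 0 ≡ rnBound + (+ (ℓ 0 ℕ.+ ℓ m) - + ε dist) + sumFrom gap 0 m
    span-decomposition = begin
      X m - X 0
        ≡⟨ cong (_- X 0) (telescope X (+ c) pairLevel 0 m) ⟩
      X 0 + + m * + c - sumFrom pairLevel 0 m + sumFrom gap 0 m - X 0
        ≡⟨ cong (λ S → X 0 + + m * + c - S + sumFrom gap 0 m - X 0) (sum-pairLevel u-inj) ⟩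
      X 0 + + m * + c - ((+ totalLevel dist - + ℓ m) + (+ totalLevel dist - + ℓ 0)) + sumFrom gap 0 m - X 0
        ≡⟨ regroup (X 0) (+ m) (+ D) (+ ε dist) (+ totalLevel dist) (+ ℓ 0) (+ ℓ m) (sumFrom gap 0 m) ⟩
      rnBound + (+ (ℓ 0 ℕ.+ ℓ m) - + ε dist) + sumFrom gap 0 m  ∎
      where
        open ≡.≡-Reasoning
        regroup : ∀ x₀ m' D E T a b S →
          x₀ + m' * (D + E) - ((T - b) + (T - a)) + S - x₀ ≡ ((m' * (D + E) - + 2 * T) + E) + ((a + b) - E) + S
        regroup = solve-∀

    X-range≤span : X m - X 0 ≤ + span dist g
    X-range≤span = subst (_≤ + span dist g) (label-difference z≤n ℕₚ.≤-refl)
      (+≤+ (≤-maxL (λ uv → ℕ.∣ g (proj₁ uv) - g (proj₂ uv) ∣) (∈-pairs (vertex 0) (vertex m))))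

    ends-excess≥0 : 0ℤ ≤ + (ℓ 0 ℕ.+ ℓ m) - + ε dist
    ends-excess≥0 = i≤j⇒0≤j-i (+≤+ (ε≤levels (ℕₚ.<⇒≢ m≥1 ∘ vertex-injective u-inj z≤n ℕₚ.≤-refl)))

    gaps≥0 : 0ℤ ≤ sumFrom gap 0 m
    gaps≥0 = sumFrom-nonneg gap m gap≥0

    excess≤span-rnBound : (+ (ℓ 0 ℕ.+ ℓ m) - + ε dist) + sumFrom gap 0 m ≤ + span dist g - rnBound
    excess≤span-rnBound =
      ≤-by-difference (i≤j⇒0≤j-i (subst (_≤ + span dist g) span-decomposition X-range≤span))
                      (regroup (+ span dist g) rnBound (+ (ℓ 0 ℕ.+ ℓ m) - + ε dist) (sumFrom gap 0 m))
      where
        regroup : ∀ S B e s → S - B - (e + s) ≡ S - (B + e + s)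
        regroup = solve-∀

    rnBound≤span : rnBound ≤ + span dist g
    rnBound≤span = 0≤i-j⇒j≤i (≤-trans (+-mono-≤ ends-excess≥0 gaps≥0) excess≤span-rnBound)

    tight : + span dist g ≡ rnBound → (ℓ 0 ℕ.+ ℓ m ≡ ε dist) × (∀ t → t ℕ.< m → gap t ≡ 0ℤ)
    tight span≡ = ℤₚ.+-injective (i-j≡0⇒i≡j (+ (ℓ 0 ℕ.+ ℓ m)) (+ ε dist) (proj₁ zeros)) ,
                  sumFrom-nonneg-≤0 gap m gap≥0 (≤-reflexive (proj₂ zeros))
      where
        excess≤0 : (+ (ℓ 0 ℕ.+ ℓ m) - + ε dist) + sumFrom gap 0 m ≤ 0ℤ
        excess≤0 = subst ((+ (ℓ 0 ℕ.+ ℓ m) - + ε dist) + sumFrom gap 0 m ≤_) (i≡j⇒i-j≡0 span≡) excess≤span-rnBound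
        zeros : (+ (ℓ 0 ℕ.+ ℓ m) - + ε dist ≡ 0ℤ) × (sumFrom gap 0 m ≡ 0ℤ)
        zeros = nonneg-sum≤0 ends-excess≥0 gaps≥0 excess≤0

    gaps≡0⇒tight-labels : (∀ t → t ℕ.< m → gap t ≡ 0ℤ) → TightLabels X
    gaps≡0⇒tight-labels gaps≡0 i k i+k≤m =
      ≡.trans (telescope X (+ c) pairLevel i k)
              (≡.trans (cong (λ s → X i + + k * + c - sumFrom pairLevel i k + s)
                             (sumFrom-zero gap i k (λ t t< → gaps≡0 t (ℕₚ.<-≤-trans t< i+k≤m))))
                       (ℤₚ.+-identityʳ _))

    gaps≡0⇒condB : (∀ t → t ℕ.< m → gap t ≡ 0ℤ) → CondB G dist u
    gaps≡0⇒condB gaps≡0 i j i<j j≤m =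
      ≤-by-difference (i≤j⇒0≤j-i (radio-along i<j j≤m))
                      (condB-slack≡radio-slack {X} (gaps≡0⇒tight-labels gaps≡0) (ℕₚ.<⇒≤ i<j) j≤m)

  module SortedOrder (g : Fin (suc m) → ℕ) where
    open import Data.List.Sort (On.decTotalOrder ℕₚ.≤-decTotalOrder g) using (sort; sort-↭; sort-↗)

    sorted : List (Fin (suc m))
    sorted = sort (allFin (suc m))

    length-sorted : length sorted ≡ suc m
    length-sorted = ≡.trans (↭-length (sort-↭ (allFin (suc m)))) (Listₚ.length-tabulate (λ i → i))

    order : Fin (suc m) → Fin (suc m)
    order k = lookup sorted (cast (≡.sym length-sorted) k)

    toℕ-cast-toIx : ∀ t → t ℕ.≤ m → toℕ (cast (≡.sym length-sorted) (toIx m t)) ≡ t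
    toℕ-cast-toIx t t≤m = ≡.trans (Finₚ.toℕ-cast _ (toIx m t)) (toℕ-toIx m t t≤m)

    order-injective : Injective _≡_ _≡_ order
    order-injective {k} {k'} eq = Finₚ.toℕ-injective (≡.trans (≡.sym (Finₚ.toℕ-cast _ k))
      (≡.trans (cong toℕ (unique-lookup-injective sorted-unique eq)) (Finₚ.toℕ-cast _ k')))
      where
        sorted-unique : Unique sorted
        sorted-unique = ↭ₛ.Unique-resp-↭ (≡.setoid _) (↭⇒↭ₛ (↭-sym (sort-↭ (allFin (suc m)))))
                                         (Uniqueₚ.allFin⁺ (suc m))

    order-step : ∀ t → t ℕ.< m → g (at G dist order t) ℕ.≤ g (at G dist order (suc t))
    order-step t t<m = lookup-mono-≤ (On.totalOrder ℕₚ.≤-totalOrder g) (sort-↗ (allFin (suc m)))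
      (≡.subst₂ ℕ._≤_ (≡.sym (toℕ-cast-toIx t (ℕₚ.<⇒≤ t<m))) (≡.sym (toℕ-cast-toIx (suc t) t<m)) (ℕₚ.n≤1+n t))

  rnBound≤span : 1 ℕ.≤ m → ∀ g → IsRadioLabeling dist g → rnBound ≤ + span dist g
  rnBound≤span m≥1 g g-radio = LowerBound.rnBound≤span m≥1 order order-injective g g-radio order-step
    where open SortedOrder g

  module Reversal (m≥1 : 1 ℕ.≤ m) (u : Fin (suc m) → Fin (suc m)) (u-inj : Injective _≡_ _≡_ u)
                  (g : Fin (suc m) → ℕ) (g-radio : IsRadioLabeling dist g)
                  (g-step : ∀ t → t ℕ.< m → g (at G dist u t) ℕ.≤ g (at G dist u (suc t))) where
    open Order u
    open LowerBound m≥1 u u-inj g g-radio g-step using (X-monotone)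

    K : ℕ
    K = g (vertex m)

    u' : Fin (suc m) → Fin (suc m)
    u' = u ∘ opposite

    g' : Fin (suc m) → ℕ
    g' v = K ℕ.∸ g v

    u'-injective : Injective _≡_ _≡_ u'
    u'-injective {k} {k'} eq = ≡.trans (≡.sym (Finₚ.opposite-involutive k))
      (≡.trans (cong opposite (u-inj eq)) (Finₚ.opposite-involutive k'))

    vertex'≡ : ∀ t → t ℕ.≤ m → at G dist u' t ≡ vertex (m ℕ.∸ t)
    vertex'≡ t t≤m = cong u (opposite-toIx m t t≤m)

    g≤K : ∀ v → g v ℕ.≤ K
    g≤K v with Reindexing.surjective u u-inj v
    ... | k , refl = subst (λ x → g x ℕ.≤ K) (cong u (toIx-toℕ m k))
                       (drop‿+≤+ (X-monotone (s≤s⁻¹ (Finₚ.toℕ<n k)) ℕₚ.≤-refl))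

    g'-radio : IsRadioLabeling dist g'
    g'-radio v v' v≢v' = subst (λ x → D ℕ.+ 1 ℕ.≤ dist v v' ℕ.+ x)
                               (≡.sym (∣K∸a-K∸b∣≡∣a-b∣ (g≤K v) (g≤K v'))) (g-radio v v' v≢v')

    span-g' : span dist g' ≡ span dist g
    span-g' = cong maxL (Listₚ.map-cong (λ (v , v') → ∣K∸a-K∸b∣≡∣a-b∣ (g≤K v) (g≤K v')) pairs)

    g'-step : ∀ t → t ℕ.< m → g' (at G dist u' t) ℕ.≤ g' (at G dist u' (suc t))
    g'-step t t<m = ≡.subst₂ (λ a b → K ℕ.∸ g a ℕ.≤ K ℕ.∸ g b)
      (≡.sym (vertex'≡ t (ℕₚ.<⇒≤ t<m))) (≡.sym (vertex'≡ (suc t) t<m))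
      (ℕₚ.∸-monoʳ-≤ K (subst (λ s → g (vertex (m ℕ.∸ suc t)) ℕ.≤ g (vertex s)) (≡.sym m∸t≡)
                             (g-step (m ℕ.∸ suc t) (subst (ℕ._≤ m) m∸t≡ (ℕₚ.m∸n≤m m t)))))
      where
        m∸t≡ : m ℕ.∸ t ≡ suc (m ℕ.∸ suc t)
        m∸t≡ = ℕₚ.+-∸-assoc 1 t<m

    first'≡vertex-m : at G dist u' 0 ≡ vertex m
    first'≡vertex-m = vertex'≡ 0 z≤n

  module Construction (m≥1 : 1 ℕ.≤ m) (u : Fin (suc m) → Fin (suc m)) (u-inj : Injective _≡_ _≡_ u)
                      (condA : CondA G dist u) (condB : CondB G dist u) where
    open Order u

    X : ℕ → ℤ
    X = labelSeq G dist u

    X-tight : TightLabels X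
    X-tight i k _ =
      ≡.trans (telescope X (+ c) pairLevel i k)
              (≡.trans (cong (λ s → X i + + k * + c - sumFrom pairLevel i k + s) (sumFrom-zero _ i k (λ t _ → gap≡0 t)))
                       (ℤₚ.+-identityʳ _))
      where
        cancel : ∀ x a b c → ((x - a) - b) + c - x - c + (b + a) ≡ 0ℤ
        cancel = solve-∀
        gap≡0 : ∀ t → slack X (+ c) pairLevel t ≡ 0ℤ
        gap≡0 t = cancel (X t) (+ ℓ (suc t)) (+ ℓ t) (+ c)

    X-radio-along : ∀ {i j} → i ℕ.< j → j ℕ.≤ m → + (D ℕ.+ 1) ≤ + dist (vertex i) (vertex j) + (X j - X i)
    X-radio-along i<j j≤m = ≤-by-difference (i≤j⇒0≤j-i (condB _ _ i<j j≤m))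
                                            (≡.sym (condB-slack≡radio-slack {X} X-tight (ℕₚ.<⇒≤ i<j) j≤m))

    X-step : ∀ t → t ℕ.< m → X t ≤ X (suc t)
    X-step t t<m = ≤-by-difference
      (+-mono-≤ (+-mono-≤ (i≤j⇒0≤j-i (X-radio-along (ℕₚ.n<1+n t) t<m))
                          (i≤j⇒0≤j-i (+≤+ (dist≤diam (vertex t) (vertex (suc t))))))
                (+≤+ z≤n))
      (regroup (X t) (X (suc t)) (+ dist (vertex t) (vertex (suc t))) (+ D))
      where
        regroup : ∀ x x' d D → x' - x ≡ ((d + (x' - x)) - (D + + 1)) + (D - d) + + 1
        regroup = solve-∀

    X-monotone : ∀ {i j} → i ℕ.≤ j → j ℕ.≤ m → X i ≤ X j
    X-monotone = monotone-from-steps X X-step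

    label : ℕ → ℕ
    label t = ℤ.∣ X t ∣

    +label≡X : ∀ {t} → t ℕ.≤ m → + label t ≡ X t
    +label≡X t≤m = 0≤i⇒+∣i∣≡i (X-monotone z≤n t≤m)

    label-monotone : ∀ {i j} → i ℕ.≤ j → j ℕ.≤ m → label i ℕ.≤ label j
    label-monotone i≤j j≤m =
      drop‿+≤+ (≡.subst₂ _≤_ (≡.sym (+label≡X (ℕₚ.≤-trans i≤j j≤m))) (≡.sym (+label≡X j≤m))
                             (X-monotone i≤j j≤m))

    radio-ordered : ∀ {i j} → i ℕ.< j → j ℕ.≤ m →
                    D ℕ.+ 1 ℕ.≤ dist (vertex i) (vertex j) ℕ.+ ℕ.∣ label i - label j ∣
    radio-ordered {i} {j} i<j j≤m = drop‿+≤+ (subst (λ x → + (D ℕ.+ 1) ≤ + dist (vertex i) (vertex j) + x)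
      (≡.sym (≡.trans (+∣m-n∣≡+n-+m (label-monotone (ℕₚ.<⇒≤ i<j) j≤m))
                      (cong₂ _-_ (+label≡X j≤m) (+label≡X (ℕₚ.≤-trans (ℕₚ.<⇒≤ i<j) j≤m)))))
      (X-radio-along i<j j≤m))

    position : Fin (suc m) → ℕ
    position v = toℕ (proj₁ (Reindexing.surjective u u-inj v))

    position≤m : ∀ v → position v ℕ.≤ m
    position≤m v = s≤s⁻¹ (Finₚ.toℕ<n _)

    vertex-position : ∀ v → vertex (position v) ≡ v
    vertex-position v = ≡.trans (cong u (toIx-toℕ m _)) (proj₂ (Reindexing.surjective u u-inj v))

    f : Fin (suc m) → ℕ
    f v = label (position v)

    f-vertex : ∀ {i} → i ℕ.≤ m → f (vertex i) ≡ label i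
    f-vertex i≤m = cong label (vertex-injective u-inj (position≤m _) i≤m (vertex-position _))

    f-radio : IsRadioLabeling dist f
    f-radio v v' v≢v' with ℕₚ.<-cmp (position v) (position v')
    ... | tri< p<p' _ _ = ≡.subst₂ (λ a b → D ℕ.+ 1 ℕ.≤ dist a b ℕ.+ ℕ.∣ f v - f v' ∣)
                            (vertex-position v) (vertex-position v') (radio-ordered p<p' (position≤m v'))
    ... | tri≈ _ p≡p' _ =
      ⊥-elim (v≢v' (≡.trans (≡.sym (vertex-position v)) (≡.trans (cong vertex p≡p') (vertex-position v'))))
    ... | tri> _ _ p'<p = ≡.subst₂ (λ a b → D ℕ.+ 1 ℕ.≤ dist a b ℕ.+ ℕ.∣ f v - f v' ∣)
                            (vertex-position v) (vertex-position v')
                            (subst (D ℕ.+ 1 ℕ.≤_) (cong₂ ℕ._+_ (dist-sym _ _) (ℕₚ.∣-∣-comm (f v') (f v)))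
                                   (radio-ordered p'<p (position≤m v)))

    span-f≡label-m : span dist f ≡ label m
    span-f≡label-m = ℕₚ.≤-antisym
      (maxL-lub _ pairs (λ {(v , v')} _ →
         ℕₚ.≤-trans (ℕₚ.∣m-n∣≤m⊔n (f v) (f v')) (ℕₚ.⊔-lub (f≤label-m v) (f≤label-m v'))))
      (subst (ℕ._≤ span dist f) ends
         (≤-maxL (λ uv → ℕ.∣ f (proj₁ uv) - f (proj₂ uv) ∣) (∈-pairs (vertex 0) (vertex m))))
      where
        f≤label-m : ∀ v → f v ℕ.≤ label m
        f≤label-m v = label-monotone (position≤m v) ℕₚ.≤-refl
        ends : ℕ.∣ f (vertex 0) - f (vertex m) ∣ ≡ label m
        ends = cong₂ ℕ.∣_-_∣ (f-vertex z≤n) (f-vertex ℕₚ.≤-refl)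

    ends-levels : ℓ 0 ℕ.+ ℓ m ≡ ε dist
    ends-levels = subst (λ z → ℓ 0 ℕ.+ L z ≡ ε dist) last≡vertex-m (ends-condition⇒levels≡ε condA)

    span-f≡rnBound : + span dist f ≡ rnBound
    span-f≡rnBound = begin
      + span dist f                                      ≡⟨ cong +_ span-f≡label-m ⟩
      + label m                                          ≡⟨ +label≡X ℕₚ.≤-refl ⟩
      X m                                                ≡⟨ X-tight 0 m ℕₚ.≤-refl ⟩
      0ℤ + + m * + c - sumFrom pairLevel 0 m             ≡⟨ cong (λ S → 0ℤ + + m * + c - S) (sum-pairLevel u-inj) ⟩
      0ℤ + + m * + c - ((+ totalLevel dist - + ℓ m) + (+ totalLevel dist - + ℓ 0))
        ≡⟨ regroup (+ m * + c) (+ totalLevel dist) (+ ℓ 0) (+ ℓ m) ⟩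
      + m * + c - + 2 * + totalLevel dist + + (ℓ 0 ℕ.+ ℓ m)
        ≡⟨ cong (λ e → + m * + c - + 2 * + totalLevel dist + + e) ends-levels ⟩
      rnBound                                            ∎
      where
        open ≡.≡-Reasoning
        regroup : ∀ mc T a b → 0ℤ + mc - ((T - b) + (T - a)) ≡ mc - + 2 * T + (a + b)
        regroup = solve-∀

    optimal : LabelingOptimal G dist u
    optimal = f , (λ i i≤m → ≡.trans (cong +_ (f-vertex i≤m)) (+label≡X i≤m)) , f-radio ,
              λ g g-radio → drop‿+≤+ (subst (_≤ + span dist g) (≡.sym span-f≡rnBound) (rnBound≤span m≥1 g g-radio))

  tight-labeling⇒admissible-order : 1 ℕ.≤ m → ∀ u → Injective _≡_ _≡_ u → ∀ g → IsRadioLabeling dist g →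
    (∀ t → t ℕ.< m → g (at G dist u t) ℕ.≤ g (at G dist u (suc t))) →
    + span dist g ≡ rnBound → L (at G dist u 0) ≡ 0 → AdmissibleOrder
  tight-labeling⇒admissible-order m≥1 u u-inj g g-radio g-step span≡ ℓ0≡0 =
    u , u-inj , condA , gaps≡0⇒condB (proj₂ tightness)
    where
      open Order u
      open LowerBound m≥1 u u-inj g g-radio g-step
      tightness : (ℓ 0 ℕ.+ ℓ m ≡ ε dist) × (∀ t → t ℕ.< m → gap t ≡ 0ℤ)
      tightness = tight span≡
      condA : CondA G dist u
      condA = subst (EndsCondition (vertex 0)) (≡.sym last≡vertex-m)
                    (levels≡ε⇒ends-condition (ℕₚ.<⇒≢ m≥1 ∘ vertex-injective u-inj z≤n ℕₚ.≤-refl)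
                                             ℓ0≡0 (proj₁ tightness))

  -- Sort the vertices by an optimal labelling g; one end of the order has level 0, and if it is the
  -- last vertex, reading the order backwards with labels max g − g gives an equally tight labelling.
  rn≡rnBound⇒admissible-order : 1 ℕ.≤ m → RadioNumberIs dist rnBound → AdmissibleOrder
  rn≡rnBound⇒admissible-order m≥1 ((g , g-radio , span≡) , _) =
    [ tight-labeling⇒admissible-order m≥1 order order-injective g g-radio order-step span≡
    , (λ ℓm≡0 → tight-labeling⇒admissible-order m≥1 u' u'-injective g' g'-radio g'-step
                                                  (≡.trans (cong +_ span-g') span≡)
                                                  (≡.trans (cong L first'≡vertex-m) ℓm≡0))
    ]′ (levels≡ε⇒level≡0 (proj₁ (tight span≡)))
    where
      open SortedOrder g
      open LowerBound m≥1 order order-injective g g-radio order-step using (tight)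
      open Reversal m≥1 order order-injective g g-radio order-step

  admissible-order⇒rn≡rnBound : 1 ℕ.≤ m → AdmissibleOrder → RadioNumberIs dist rnBound
  admissible-order⇒rn≡rnBound m≥1 (u , u-inj , condA , condB) = (f , f-radio , span-f≡rnBound) , rnBound≤span m≥1
    where open Construction m≥1 u u-inj condA condB

open import Data.Nat using (_+_; _*_; _≤_)
open import Data.Integer using (+_)

theorem3p2 : (m : ℕ) (G : SimpleGraph (suc m)) → IsTree G →
    (dist : Fin (suc m) → Fin (suc m) → ℕ) → IsDistance G dist →
    2 ≤ diam dist →
    (RadioNumberIs dist
        (((+ m) ℤ.* (+ (diam dist + ε dist)) ℤ.- (+ 2) ℤ.* (+ totalLevel dist)) ℤ.+ (+ ε dist))
      ⇔ (∃[ u ] LinearOrder G dist u × CondA G dist u × CondB G dist u))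
    × (∀ u → LinearOrder G dist u → CondA G dist u → CondB G dist u →
         LabelingOptimal G dist u)
theorem3p2 m G (_ , acyclic) dist isDist 2≤diam =
  mk⇔ (rn≡rnBound⇒admissible-order m≥1) (admissible-order⇒rn≡rnBound m≥1) ,
  λ u u-inj condA condB → Construction.optimal m≥1 u u-inj condA condB
  where
    open RadioNumber m G acyclic dist isDist
    m≥1 : 1 ≤ m
    m≥1 = diam≥1⇒two-vertices m isDist (ℕₚ.≤-trans (s≤s z≤n) 2≤diam)
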